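{- For every $k\geq 2$ and $w\geq 2$, there exists a finite poset $P$ of width $w$ not containing $\mathbf{k}+\mathbf{k}$ on which First-Fit can be forced to use at least $(k-1)(w-1)$ chains; that is, there is an ordering of the elements of $P$ for which First-Fit produces at least $(k-1)(w-1)$ chains.
   Context: The width of a poset is the maximum size of an antichain. $\mathbf{k}+\mathbf{k}$ denotes the poset consisting of two disjoint chains $A,B$ with $|A|=|B|=k$ in which every element of $A$ is incomparable to every element of $B$; "$P$ does not contain $\mathbf{k}+\mathbf{k}$" means $P$ has no two such disjoint mutually incomparable chains of size $k$. The First-Fit algorithm processes the elements of $P$ one at a time in a given order, putting each new element $v$ into the first chain of the current list of chains all of whose elements are comparable to $v$, and starting a new chain at the end of the list if there is none. -}

module Defs where

open import Level using (0ℓ)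
open import Data.Nat using (ℕ; _≤_)
open import Data.Fin using (Fin)
open import Data.List using (List; []; _∷_; [_]; length; foldl)
open import Data.List.Relation.Unary.All as All using (All)
open import Data.List.Relation.Unary.AllPairs using (AllPairs)
open import Data.List.Relation.Unary.Unique.Propositional using (Unique)
open import Data.Product using (_×_; Σ)
open import Data.Sum using (_⊎_)
open import Relation.Nullary using (¬_; yes; no)
open import Relation.Nullary.Decidable using (_⊎-dec_)
open import Relation.Binary using (Rel)
open import Relation.Binary.Structures using (IsDecPartialOrder)
open import Relation.Binary.PropositionalEquality using (_≡_)

module Poset {n : ℕ} (_≼_ : Rel (Fin n) 0ℓ) (po : IsDecPartialOrder _≡_ _≼_) where
  open IsDecPartialOrder po using (_≤?_)

  Comparable : Fin n → Fin n → Set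
  Comparable x y = (x ≼ y) ⊎ (y ≼ x)

  Incomparable : Fin n → Fin n → Set
  Incomparable x y = ¬ Comparable x y

  IsChain : List (Fin n) → Set
  IsChain A = Unique A × AllPairs Comparable A

  IsAntichain : List (Fin n) → Set
  IsAntichain A = Unique A × AllPairs Incomparable A

  HasWidth : ℕ → Set
  HasWidth w = Σ (List (Fin n)) (λ A → IsAntichain A × length A ≡ w)
             × (∀ (A : List (Fin n)) → IsAntichain A → length A ≤ w)

  Contains-k+k : ℕ → Set
  Contains-k+k k = Σ (List (Fin n)) λ A → Σ (List (Fin n)) λ B →
    IsChain A × IsChain B × length A ≡ k × length B ≡ k ×
    All (λ a → All (λ b → Incomparable a b) B) A

  ffInsert : List (List (Fin n)) → Fin n → List (List (Fin n))
  ffInsert [] v = [ [ v ] ]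
  ffInsert (C ∷ Cs) v with All.all? (λ c → (v ≤? c) ⊎-dec (c ≤? v)) C
  ... | yes _ = (v ∷ C) ∷ Cs
  ... | no  _ = C ∷ ffInsert Cs v

  firstFit : List (Fin n) → List (List (Fin n))
  firstFit σ = foldl ffInsert [] σ

module Submission where

-- Write d = k - 1.  The poset is a "strip order": every element sits at a
-- height in one of w columns, and x < y iff x is lower than y in the same
-- column, or at least d lower anywhere.  Incomparable elements thus lie in
-- different columns (width ≤ w), and of two mutually incomparable chains the
-- one avoiding the lowest element lies in a height window of length d, so it
-- has at most d elements (no (d + 1) + (d + 1)).
--
-- First-Fit is analysed through labels: if equally labelled elements are
-- comparable, and each element v has, for every smaller label c, an earlier
-- element of label c incomparable to v, then First-Fit puts v into chain
-- number lab v.  In the construction the elements are triples (r , t , a)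
-- (row r < d, block t < d, label column a < w) at height r + t·d, in column
-- a rotated t times, with label (min r (d - 1 - t) , a); these d·w labels
-- satisfy both hypotheses, a witness whose column clashes with v being moved
-- to the next block.

open import Defs
open import Level using (0ℓ)
open import Data.Empty using (⊥; ⊥-elim)
open import Data.Fin as F using (Fin; toℕ; fromℕ<; suc; zero; combine; remQuot)
import Data.Fin.Properties as Fₚ
open import Data.Fin.Properties
  using ( pigeonhole; fromℕ<-injective; toℕ-injective; toℕ<n; toℕ-fromℕ<; toℕ-fromℕ
        ; toℕ-combine; combine-monoˡ-<; combine-remQuot; remQuot-combine; combine-injective
        ; fromℕ≢inject₁; inject₁-injective; toℕ-inject₁ )
open import Data.List using (List; []; _∷_; [_]; _++_; length; allFin; lookup; tabulate; foldl)
open import Data.List.Extrema.Nat using (argmin; argmin-sel; f[argmin]≤f[⊤]; f[argmin]≤f[xs])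
open import Data.List.Membership.Propositional using (_∈_)
open import Data.List.Membership.Propositional.Properties using (∈-lookup; ∈-++⁻)
open import Data.List.Properties using (length-tabulate)
open import Data.List.Relation.Binary.Permutation.Propositional using (_↭_; ↭-refl)
open import Data.List.Relation.Unary.All as All using (All; []; _∷_)
import Data.List.Relation.Unary.All.Properties as All
open import Data.List.Relation.Unary.AllPairs as AllPairs using (AllPairs; []; _∷_)
import Data.List.Relation.Unary.AllPairs.Properties as AllPairs
open import Data.List.Relation.Unary.Any using (here; there)
import Data.List.Relation.Unary.Unique.Propositional.Properties as Unique
open import Data.Nat as ℕ
  using (ℕ; zero; suc; _+_; _*_; _∸_; _⊓_; _≤_; _<_; z≤n; s≤s; NonZero; >-nonZero⁻¹)
open import Data.Nat.Properties
  using ( ≤-reflexive; ≤-trans; <-trans; <-≤-trans; ≤-<-trans; <⇒≤; <⇒≢; ≮⇒≥; ≰⇒>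
        ; <-irrefl; <-asym; <-cmp; ≤-pred; <⇒≤pred; m≤n⇒m<n∨m≡n; n≮0; 1+n≢n; n≤1+n
        ; +-identityʳ; +-suc; +-assoc; +-comm; *-comm; +-cancelˡ-<; ∸-cancelʳ-≡
        ; m<m+n; m≤m+n; m≤n+m; m+[n∸m]≡n; +-mono-≤; +-monoˡ-≤; +-monoˡ-<; *-monoˡ-≤; *-monoʳ-≤
        ; m⊓n≤m; m⊓n≤n; m≤n⇒m⊓n≡m; ⊓-sel; ∸-monoʳ-<; m∸n≢0⇒n<m; pred[m∸n]≡m∸[1+n]
        ; module ≤-Reasoning )
open import Data.Product as Product using (Σ; _×_; _,_; proj₁; proj₂)
open import Data.Sum as Sum using (_⊎_; inj₁; inj₂)
open import Function using (id; _∘_; _$_)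
open import Relation.Binary using (Rel)
open import Relation.Binary.Definitions using (tri<; tri≈; tri>)
open import Relation.Binary.PropositionalEquality as ≡
  using (_≡_; _≢_; refl; sym; trans; cong; cong₂; subst; subst₂; ≢-sym)
open import Relation.Binary.Structures using (IsDecPartialOrder)
open import Relation.Nullary using (¬_; Dec; yes; no)
open import Relation.Nullary.Decidable using (_⊎-dec_; _×-dec_)

module _ {A : Set} where

  allPairs-lookup : ∀ {R : Rel A 0ℓ} {xs} → AllPairs R xs →
                    ∀ {i j : Fin (length xs)} → i F.< j → R (lookup xs i) (lookup xs j)
  allPairs-lookup (Rx ∷ _)   {zero}  {suc j} _         = All.lookup Rx (∈-lookup j)
  allPairs-lookup (_ ∷ Rxs)  {suc i} {suc j} (s≤s i<j) = allPairs-lookup Rxs i<j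

  pigeonhole-window : ∀ (f : A → ℕ) (p m : ℕ) {xs : List A} →
                      AllPairs (λ x y → f x ≢ f y) xs →
                      All (λ x → p ≤ f x × f x < p + m) xs → length xs ≤ m
  pigeonhole-window f p m {xs} distinct inWindow = ≮⇒≥ λ m<len →
    let (i , j , i<j , same) = pigeonhole m<len offset
    in allPairs-lookup distinct i<j
         (∸-cancelʳ-≡ (low i) (low j) (fromℕ<-injective _ _ (offset< i) (offset< j) same))
    where
    low : ∀ i → p ≤ f (lookup xs i)
    low i = proj₁ (All.lookup inWindow (∈-lookup i))
    offset< : ∀ i → f (lookup xs i) ∸ p < m
    offset< i = +-cancelˡ-< p _ m
      (subst (_< p + m) (sym (m+[n∸m]≡n (low i))) (proj₂ (All.lookup inWindow (∈-lookup i))))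
    offset : Fin (length xs) → Fin m
    offset i = fromℕ< (offset< i)

module FirstFitBound {n : ℕ} (_≼_ : Rel (Fin n) 0ℓ) (po : IsDecPartialOrder _≡_ _≼_) where
  open Poset _≼_ po
  open IsDecPartialOrder po using (_≤?_)

  Chains : Set
  Chains = List (List (Fin n))

  chainAt : Chains → ℕ → List (Fin n)
  chainAt []       _       = []
  chainAt (C ∷ Cs) zero    = C
  chainAt (C ∷ Cs) (suc i) = chainAt Cs i

  ∈chainAt⇒< : ∀ Cs i {x} → x ∈ chainAt Cs i → i < length Cs
  ∈chainAt⇒< []       i       ()
  ∈chainAt⇒< (C ∷ Cs) zero    _   = s≤s z≤n
  ∈chainAt⇒< (C ∷ Cs) (suc i) x∈  = s≤s (∈chainAt⇒< Cs i x∈)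

  addAt : ℕ → Fin n → Chains → Chains
  addAt zero    v []       = [ v ] ∷ []
  addAt zero    v (C ∷ Cs) = (v ∷ C) ∷ Cs
  addAt (suc i) v []       = [] ∷ addAt i v []
  addAt (suc i) v (C ∷ Cs) = C ∷ addAt i v Cs

  ffInsert≡addAt : ∀ Cs i v → i ≤ length Cs →
                   (∀ j → j < i → ¬ All (Comparable v) (chainAt Cs j)) →
                   All (Comparable v) (chainAt Cs i) → ffInsert Cs v ≡ addAt i v Cs
  ffInsert≡addAt []       zero    v _ _ _ = refl
  ffInsert≡addAt (C ∷ Cs) zero    v _ _ fits with All.all? (λ c → (v ≤? c) ⊎-dec (c ≤? v)) C
  ... | yes _   = refl
  ... | no  ¬fits = ⊥-elim (¬fits fits)
  ffInsert≡addAt (C ∷ Cs) (suc i) v (s≤s i≤) blocked fits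
    with All.all? (λ c → (v ≤? c) ⊎-dec (c ≤? v)) C
  ... | yes all = ⊥-elim (blocked zero (s≤s z≤n) all)
  ... | no  _   =
    cong (C ∷_) (ffInsert≡addAt Cs i v i≤ (λ j j<i → blocked (suc j) (s≤s j<i)) fits)

  ∈-addAt : ∀ i v Cs j {x} → x ∈ chainAt (addAt i v Cs) j → (x ≡ v × j ≡ i) ⊎ x ∈ chainAt Cs j
  ∈-addAt zero    v []       zero    (here x≡v) = inj₁ (x≡v , refl)
  ∈-addAt zero    v (C ∷ Cs) zero    (here x≡v) = inj₁ (x≡v , refl)
  ∈-addAt zero    v (C ∷ Cs) zero    (there x∈) = inj₂ x∈
  ∈-addAt zero    v (C ∷ Cs) (suc j) x∈         = inj₂ x∈
  ∈-addAt (suc i) v (C ∷ Cs) zero    x∈         = inj₂ x∈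
  ∈-addAt (suc i) v []       (suc j) x∈         = Sum.map₁ shift (∈-addAt i v [] j x∈)
    where shift = λ (x≡v , j≡i) → x≡v , cong suc j≡i
  ∈-addAt (suc i) v (C ∷ Cs) (suc j) x∈         = Sum.map₁ shift (∈-addAt i v Cs j x∈)
    where shift = λ (x≡v , j≡i) → x≡v , cong suc j≡i

  addAt-new : ∀ i v Cs → v ∈ chainAt (addAt i v Cs) i
  addAt-new zero    v []       = here refl
  addAt-new zero    v (C ∷ Cs) = here refl
  addAt-new (suc i) v []       = addAt-new i v []
  addAt-new (suc i) v (C ∷ Cs) = addAt-new i v Cs

  addAt-old : ∀ i v Cs j {x} → x ∈ chainAt Cs j → x ∈ chainAt (addAt i v Cs) j
  addAt-old zero    v (C ∷ Cs) zero    x∈ = there x∈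
  addAt-old zero    v (C ∷ Cs) (suc j) x∈ = x∈
  addAt-old (suc i) v (C ∷ Cs) zero    x∈ = x∈
  addAt-old (suc i) v (C ∷ Cs) (suc j) x∈ = addAt-old i v Cs j x∈

  module _ (lab : Fin n → ℕ)
           (same-label : ∀ x y → lab x ≡ lab y → Comparable x y)
           (witness : ∀ v c → c < lab v →
                      Σ (Fin n) λ x → toℕ x < toℕ v × lab x ≡ c × Incomparable v x) where

    record Invariant (m : ℕ) (Cs : Chains) : Set where
      field
        labelled : ∀ {i x} → x ∈ chainAt Cs i → lab x ≡ i
        complete : ∀ x → toℕ x < m → x ∈ chainAt Cs (lab x)

    insert-step : ∀ v Cs → Invariant (toℕ v) Cs → Invariant (suc (toℕ v)) (ffInsert Cs v)
    insert-step v Cs inv =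
      subst (Invariant (suc (toℕ v))) (sym (ffInsert≡addAt Cs (lab v) v room blocked fits))
        record { labelled = labelled′ ; complete = complete′ }
      where
      open Invariant inv
      -- the witness of label j is already in chain j
      blocked : ∀ j → j < lab v → ¬ All (Comparable v) (chainAt Cs j)
      blocked j j<lab comparable with witness v j j<lab
      ... | x , x<v , refl , v∥x = v∥x (All.lookup comparable (complete x x<v))
      occupied : ∀ j → j < lab v → j < length Cs
      occupied j j<lab with witness v j j<lab
      ... | x , x<v , refl , _ = ∈chainAt⇒< Cs (lab x) (complete x x<v)
      room : lab v ≤ length Cs
      room = ≮⇒≥ λ len<lab → <-irrefl refl (occupied (length Cs) len<lab)
      fits : All (Comparable v) (chainAt Cs (lab v))
      fits = All.tabulate λ {y} y∈ → same-label v y (sym (labelled y∈))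
      labelled′ : ∀ {i x} → x ∈ chainAt (addAt (lab v) v Cs) i → lab x ≡ i
      labelled′ {i} x∈ with ∈-addAt (lab v) v Cs i x∈
      ... | inj₁ (refl , refl) = refl
      ... | inj₂ x∈old         = labelled x∈old
      complete′ : ∀ x → toℕ x < suc (toℕ v) → x ∈ chainAt (addAt (lab v) v Cs) (lab x)
      complete′ x x≤v with m≤n⇒m<n∨m≡n (≤-pred x≤v)
      ... | inj₁ x<v = addAt-old (lab v) v Cs (lab x) (complete x x<v)
      ... | inj₂ x≡v with toℕ-injective x≡v
      ...   | refl = addAt-new (lab v) v Cs

    run : ∀ m s (g : Fin m → Fin n) → (∀ i → toℕ (g i) ≡ s + toℕ i) →
          ∀ Cs → Invariant s Cs → Invariant (s + m) (foldl ffInsert Cs (tabulate g))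
    run zero    s g index Cs inv = subst (λ k → Invariant k Cs) (sym (+-identityʳ s)) inv
    run (suc m) s g index Cs inv =
      subst (λ k → Invariant k (foldl ffInsert (ffInsert Cs (g zero)) (tabulate (g ∘ suc))))
            (sym (+-suc s m))
        (run m (suc s) (g ∘ suc) (λ i → trans (index (suc i)) (+-suc s (toℕ i)))
             (ffInsert Cs (g zero)) inv′)
      where
      first : toℕ (g zero) ≡ s
      first = trans (index zero) (+-identityʳ s)
      inv′ : Invariant (suc s) (ffInsert Cs (g zero))
      inv′ = subst (λ k → Invariant (suc k) (ffInsert Cs (g zero))) first
               (insert-step (g zero) Cs (subst (λ k → Invariant k Cs) (sym first) inv))

    firstFit-bound : ∀ x → lab x < length (firstFit (allFin n))
    firstFit-bound x =
      ∈chainAt⇒< (firstFit (allFin n)) (lab x) (Invariant.complete final x (toℕ<n x))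
      where
      final : Invariant n (firstFit (allFin n))
      final = run n 0 id (λ _ → refl) [] record { labelled = λ () ; complete = λ _ () }

module StripOrder {n W : ℕ} (d : ℕ) .{{_ : NonZero d}} (pos : Fin n → ℕ) (col : Fin n → Fin W)
                  (spot-injective : ∀ {x y} → pos x ≡ pos y → col x ≡ col y → x ≡ y) where

  data _⊏_ (x y : Fin n) : Set where
    same-column : col x ≡ col y → pos x < pos y → x ⊏ y
    far-below   : pos x + d ≤ pos y → x ⊏ y

  _≼_ : Rel (Fin n) 0ℓ
  x ≼ y = x ≡ y ⊎ x ⊏ y

  ⊏⇒< : ∀ {x y} → x ⊏ y → pos x < pos y
  ⊏⇒< (same-column _ lt)  = lt
  ⊏⇒< {x} (far-below far) = <-≤-trans (m<m+n (pos x) (>-nonZero⁻¹ d)) far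

  ⊏-trans : ∀ {x y z} → x ⊏ y → y ⊏ z → x ⊏ z
  ⊏-trans (same-column c₁ l₁) (same-column c₂ l₂) = same-column (trans c₁ c₂) (<-trans l₁ l₂)
  ⊏-trans (same-column _ l₁)  (far-below f₂)      = far-below (≤-trans (+-monoˡ-≤ d (<⇒≤ l₁)) f₂)
  ⊏-trans (far-below f₁)      (same-column _ l₂)  = far-below (≤-trans f₁ (<⇒≤ l₂))
  ⊏-trans {y = y} (far-below f₁) (far-below f₂)   =
    far-below (≤-trans f₁ (≤-trans (m≤m+n (pos y) d) f₂))

  _⊏?_ : ∀ x y → Dec (x ⊏ y)
  x ⊏? y with (col x F.≟ col y) ×-dec (pos x ℕ.<? pos y) | pos x + d ℕ.≤? pos y
  ... | yes (c , l) | _      = yes (same-column c l)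
  ... | no  _       | yes f  = yes (far-below f)
  ... | no  ¬s      | no  ¬f = no λ { (same-column c l) → ¬s (c , l) ; (far-below f) → ¬f f }

  isDecPartialOrder : IsDecPartialOrder _≡_ _≼_
  isDecPartialOrder = record
    { isPartialOrder = record
      { isPreorder = record
        { isEquivalence = ≡.isEquivalence
        ; reflexive     = inj₁
        ; trans         = ≼-trans
        }
      ; antisym = ≼-antisym
      }
    ; _≟_  = F._≟_
    ; _≤?_ = λ x y → (x F.≟ y) ⊎-dec (x ⊏? y)
    }
    where
    ≼-trans : ∀ {x y z} → x ≼ y → y ≼ z → x ≼ z
    ≼-trans (inj₁ refl) y≼z         = y≼z
    ≼-trans (inj₂ x⊏y)  (inj₁ refl) = inj₂ x⊏y
    ≼-trans (inj₂ x⊏y)  (inj₂ y⊏z)  = inj₂ (⊏-trans x⊏y y⊏z)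
    ≼-antisym : ∀ {x y} → x ≼ y → y ≼ x → x ≡ y
    ≼-antisym (inj₁ x≡y) _           = x≡y
    ≼-antisym (inj₂ _)   (inj₁ y≡x)  = sym y≡x
    ≼-antisym (inj₂ x⊏y) (inj₂ y⊏x)  = ⊥-elim (<-asym (⊏⇒< x⊏y) (⊏⇒< y⊏x))

  open Poset _≼_ isDecPartialOrder

  Near : ℕ → ℕ → Set
  Near a b = a < b + d × b < a + d

  far⇒comparable : ∀ {x y} → pos x + d ≤ pos y → Comparable x y
  far⇒comparable far = inj₁ (inj₂ (far-below far))

  column⇒comparable : ∀ {x y} → col x ≡ col y → Comparable x y
  column⇒comparable {x} {y} c with <-cmp (pos x) (pos y)
  ... | tri< l _ _ = inj₁ (inj₂ (same-column c l))
  ... | tri≈ _ e _ = inj₁ (inj₁ (spot-injective e c))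
  ... | tri> _ _ g = inj₂ (inj₂ (same-column (sym c) g))

  apart⇒incomparable : ∀ {x y} → col x ≢ col y → Near (pos x) (pos y) → Incomparable x y
  apart⇒incomparable c≢ _           (inj₁ (inj₁ refl))              = c≢ refl
  apart⇒incomparable c≢ _           (inj₁ (inj₂ (same-column c _))) = c≢ c
  apart⇒incomparable c≢ (_ , y<x+d) (inj₁ (inj₂ (far-below f)))     = <-irrefl refl (<-≤-trans y<x+d f)
  apart⇒incomparable c≢ _           (inj₂ (inj₁ refl))              = c≢ refl
  apart⇒incomparable c≢ _           (inj₂ (inj₂ (same-column c _))) = c≢ (sym c)
  apart⇒incomparable c≢ (x<y+d , _) (inj₂ (inj₂ (far-below f)))     = <-irrefl refl (<-≤-trans x<y+d f)

  incomparable-sym : ∀ {x y} → Incomparable x y → Incomparable y x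
  incomparable-sym x∥y = x∥y ∘ Sum.swap

  -- the width is at most W: an antichain occupies pairwise distinct columns
  width≤ : ∀ As → IsAntichain As → length As ≤ W
  width≤ As (_ , incomparable) = pigeonhole-window (toℕ ∘ col) 0 W
    (AllPairs.map (λ x∥y c → x∥y (column⇒comparable (toℕ-injective c))) incomparable)
    (All.universal (λ x → z≤n , toℕ<n (col x)) As)

  -- a chain lying above x, all of whose elements are incomparable to x, fits
  -- in the height window [pos x, pos x + d), so it has at most d elements
  short-chain : ∀ x B → IsChain B → All (λ y → pos x ≤ pos y) B → All (Incomparable x) B →
                length B ≤ d
  short-chain x B chain above incomparable = pigeonhole-window pos (pos x) d
    (AllPairs.zipWith (λ (x≢y , comparable) → distinct-heights x≢y comparable) chain)
    (All.zipWith (λ (x≤y , x∥y) → x≤y , ≰⇒> (x∥y ∘ far⇒comparable)) (above , incomparable))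
    where
    distinct-heights : ∀ {y z} → y ≢ z → Comparable y z → pos y ≢ pos z
    distinct-heights y≢z (inj₁ (inj₁ y≡z)) = ⊥-elim (y≢z y≡z)
    distinct-heights y≢z (inj₁ (inj₂ y⊏z)) = <⇒≢ (⊏⇒< y⊏z)
    distinct-heights y≢z (inj₂ (inj₁ z≡y)) = ⊥-elim (y≢z (sym z≡y))
    distinct-heights y≢z (inj₂ (inj₂ z⊏y)) = ≢-sym (<⇒≢ (⊏⇒< z⊏y))

  no-k+k : ¬ Contains-k+k (suc d)
  no-k+k ([] , _ , _ , _ , () , _)
  no-k+k (a ∷ As , B , chainA , chainB , |A| , |B| , A∥B) = lowest-in (∈-++⁻ (a ∷ As) lowest∈)
    where
    lowest : Fin n
    lowest = argmin pos a (As ++ B)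
    lowest≤ : All (λ y → pos lowest ≤ pos y) ((a ∷ As) ++ B)
    lowest≤ = f[argmin]≤f[⊤] {f = pos} a (As ++ B) ∷ f[argmin]≤f[xs] {f = pos} a (As ++ B)
    lowest∈ : lowest ∈ (a ∷ As) ++ B
    lowest∈ with argmin-sel pos a (As ++ B)
    ... | inj₁ ≡a = here ≡a
    ... | inj₂ ∈  = there ∈
    -- the chain not containing the lowest element is too short
    lowest-in : lowest ∈ a ∷ As ⊎ lowest ∈ B → ⊥
    lowest-in (inj₁ lowest∈A) = <-irrefl refl $ subst (_≤ d) |B| $
      (short-chain lowest B chainB (All.++⁻ʳ (a ∷ As) lowest≤) (All.lookup A∥B lowest∈A))
    lowest-in (inj₂ lowest∈B) = <-irrefl refl $ subst (_≤ d) |A| $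
      (short-chain lowest (a ∷ As) chainA (All.++⁻ˡ (a ∷ As) lowest≤)
        (All.map (λ a∥B → incomparable-sym (All.lookup a∥B lowest∈B)) A∥B))

module _ {m k : ℕ} where

  combine-lex : ∀ {q i : Fin m} {b j : Fin k} → combine q b F.< combine i j →
                q F.< i ⊎ (q ≡ i × b F.< j)
  combine-lex {q} {i} {b} {j} lt with Fₚ.<-cmp q i
  ... | tri< q<i _ _ = inj₁ q<i
  ... | tri≈ _ refl _ =
    inj₂ (refl , +-cancelˡ-< (k * toℕ q) (toℕ b) (toℕ j)
                   (subst₂ _<_ (toℕ-combine q b) (toℕ-combine q j) lt))
  ... | tri> _ _ i<q = ⊥-elim (<-asym lt (combine-monoˡ-< j b i<q))

  combine-below : ∀ (i : Fin m) (j : Fin k) c → c < toℕ (combine i j) →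
                  Σ (Fin m) λ q → Σ (Fin k) λ b →
                    toℕ (combine q b) ≡ c × (q F.< i ⊎ (q ≡ i × b F.< j))
  combine-below i j c c< = proj₁ pair , proj₂ pair , code ,
                           combine-lex (subst (_< toℕ (combine i j)) (sym code) c<)
    where
    c′ : Fin (m * k)
    c′ = fromℕ< (<-trans c< (toℕ<n (combine i j)))
    pair : Fin m × Fin k
    pair = remQuot {m} k c′
    code : toℕ (combine (proj₁ pair) (proj₂ pair)) ≡ c
    code = trans (cong toℕ (combine-remQuot {m} k c′)) (toℕ-fromℕ< _)

rotate : ∀ {m} → Fin (suc m) → Fin (suc m)
rotate zero    = F.fromℕ _
rotate (suc i) = F.inject₁ i

rotate-injective : ∀ {m} {i j : Fin (suc m)} → rotate i ≡ rotate j → i ≡ j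
rotate-injective {i = zero}  {zero}  _ = refl
rotate-injective {i = zero}  {suc j} e = ⊥-elim (fromℕ≢inject₁ e)
rotate-injective {i = suc i} {zero}  e = ⊥-elim (fromℕ≢inject₁ (sym e))
rotate-injective {i = suc i} {suc j} e = cong suc (inject₁-injective e)

rotate-moves : ∀ {m} (i : Fin (suc (suc m))) → rotate i ≢ i
rotate-moves zero    ()
rotate-moves (suc i) e = 1+n≢n (sym (trans (sym (toℕ-inject₁ i)) (cong toℕ e)))

-- colour t a: the column of label column a in block t
colour : ∀ {m} → ℕ → Fin (suc m) → Fin (suc m)
colour zero    a = a
colour (suc t) a = rotate (colour t a)

colour-injective : ∀ {m} t {a b : Fin (suc m)} → colour t a ≡ colour t b → a ≡ b
colour-injective zero    e = e
colour-injective (suc t) e = colour-injective t (rotate-injective e)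

module Construction (d' w' : ℕ) where

  d w n : ℕ
  d = suc d'
  w = suc (suc w')
  n = d * w * d

  -- (row r , block t , label column a)
  Coords : Set
  Coords = Fin d × Fin d × Fin w

  -- the element with given coordinates; its index codes (r , a , t)
  point : Coords → Fin n
  point (r , t , a) = combine (combine r a) t

  coords : Fin n → Coords
  coords x = rearrange (Product.map₁ (remQuot {d} w) (remQuot {d * w} d x))
    where
    rearrange : (Fin d × Fin w) × Fin d → Coords
    rearrange ((r , a) , t) = r , t , a

  coords-point : ∀ p → coords (point p) ≡ p
  coords-point (r , t , a) =
    trans (cong coords′ (remQuot-combine (combine r a) t))
          (cong (λ ra → proj₁ ra , t , proj₂ ra) (remQuot-combine r a))
    where
    coords′ : Fin (d * w) × Fin d → Coords
    coords′ (ra , t) = proj₁ (remQuot {d} w ra) , t , proj₂ (remQuot {d} w ra)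

  point-coords : ∀ x → point (coords x) ≡ x
  point-coords x =
    trans (cong (λ ra → combine ra (proj₂ split)) (combine-remQuot {d} w (proj₁ split)))
          (combine-remQuot {d * w} d x)
    where
    split : Fin (d * w) × Fin d
    split = remQuot {d * w} d x

  height : ℕ → ℕ → ℕ
  height r t = r + t * d

  level : Fin d → Fin d → Fin d
  level r t = fromℕ< (≤-<-trans (m⊓n≤m (toℕ r) (d' ∸ toℕ t)) (toℕ<n r))

  posC : Coords → ℕ
  posC (r , t , a) = height (toℕ r) (toℕ t)

  colC : Coords → Fin w
  colC (r , t , a) = colour (toℕ t) a

  labC : Coords → ℕ
  labC (r , t , a) = toℕ (combine (level r t) a)

  pos : Fin n → ℕ
  pos = posC ∘ coords

  col : Fin n → Fin w
  col = colC ∘ coords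

  lab : Fin n → ℕ
  lab = labC ∘ coords

  height-injective : ∀ {r t r′ t′ : Fin d} →
                     height (toℕ r) (toℕ t) ≡ height (toℕ r′) (toℕ t′) → r ≡ r′ × t ≡ t′
  height-injective {r} {t} {r′} {t′} e =
    Product.swap (combine-injective t r t′ r′
      (toℕ-injective (trans (code t r) (trans e (sym (code t′ r′))))))
    where
    code : ∀ t r → toℕ (combine t r) ≡ height (toℕ r) (toℕ t)
    code t r = trans (toℕ-combine t r)
                     (trans (+-comm (d * toℕ t) (toℕ r)) (cong (toℕ r +_) (*-comm d (toℕ t))))

  spot-injective : ∀ {x y} → pos x ≡ pos y → col x ≡ col y → x ≡ y
  spot-injective {x} {y} samePos sameCol =
    trans (sym (point-coords x))
          (trans (cong point (same-spot (coords x) (coords y) samePos sameCol)) (point-coords y))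
    where
    same-spot : ∀ p p′ → posC p ≡ posC p′ → colC p ≡ colC p′ → p ≡ p′
    same-spot (r , t , a) (r′ , t′ , a′) h c with height-injective {r} {t} {r′} {t′} h
    ... | refl , refl = cong (λ a → r , t , a) (colour-injective (toℕ t) c)

  open StripOrder d pos col spot-injective public
  open Poset _≼_ isDecPartialOrder
  open FirstFitBound _≼_ isDecPartialOrder using (firstFit-bound)

  toℕ-level : ∀ r t → toℕ (level r t) ≡ toℕ r ⊓ (d' ∸ toℕ t)
  toℕ-level r t = toℕ-fromℕ< _

  level≤row : ∀ r t → toℕ (level r t) ≤ toℕ r
  level≤row r t = subst (_≤ toℕ r) (sym (toℕ-level r t)) (m⊓n≤m _ _)

  level≤cap : ∀ r t → toℕ (level r t) ≤ d' ∸ toℕ t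
  level≤cap r t = subst (_≤ d' ∸ toℕ t) (sym (toℕ-level r t)) (m⊓n≤n _ _)

  level-of : ∀ {q} t → toℕ q ≤ d' ∸ toℕ t → level q t ≡ q
  level-of {q} t q≤cap = toℕ-injective (trans (toℕ-level q t) (m≤n⇒m⊓n≡m q≤cap))

  -- a label row shared with a later block is not capped, so it is the row itself
  level-shared : ∀ {r t r′ t′} → level r t ≡ level r′ t′ → toℕ t < toℕ t′ → toℕ r ≤ toℕ r′
  level-shared {r} {t} {r′} {t′} same t<t′ with ⊓-sel (toℕ r) (d' ∸ toℕ t)
  ... | inj₁ ℓ≡r = begin
    toℕ r                  ≡⟨ trans (sym ℓ≡r) (sym (toℕ-level r t)) ⟩
    toℕ (level r t)        ≡⟨ cong toℕ same ⟩
    toℕ (level r′ t′)      ≤⟨ level≤row r′ t′ ⟩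
    toℕ r′                 ∎
    where open ≤-Reasoning
  ... | inj₂ ℓ≡cap = ⊥-elim (<-irrefl refl (begin-strict
    d' ∸ toℕ t             ≡⟨ trans (sym ℓ≡cap) (sym (toℕ-level r t)) ⟩
    toℕ (level r t)        ≡⟨ cong toℕ same ⟩
    toℕ (level r′ t′)      ≤⟨ level≤cap r′ t′ ⟩
    d' ∸ toℕ t′            <⟨ ∸-monoʳ-< t<t′ (≤-pred (toℕ<n t′)) ⟩
    d' ∸ toℕ t             ∎))
    where open ≤-Reasoning

  height-step : ∀ r t → height r t + d ≡ height r (suc t)
  height-step r t = trans (+-assoc r (t * d) d) (cong (r +_) (+-comm (t * d) d))

  below-next-block : ∀ {r} q t → r < d → height r t < height q (suc t)
  below-next-block q t r<d = <-≤-trans (+-monoˡ-< (t * d) r<d) (m≤n+m _ q)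

  near-same-block : ∀ {r q} t → r < d → q < d → Near (height r t) (height q t)
  near-same-block {r} {q} t r<d q<d = below q r<d , below r q<d
    where
    below : ∀ q′ {r′} → r′ < d → height r′ t < height q′ t + d
    below q′ {r′} r′<d =
      subst (height r′ t <_) (sym (height-step q′ t)) (below-next-block q′ t r′<d)

  near-next-block : ∀ {r q} t → q < r → r < d → Near (height r t) (height q (suc t))
  near-next-block {r} {q} t q<r r<d =
    <-≤-trans (below-next-block q t r<d) (m≤m+n _ d) ,
    subst (height q (suc t) <_) (sym (height-step r t)) (+-monoˡ-< (d + t * d) q<r)

  far-later-block : ∀ {r r′ t t′} → r ≤ r′ → t < t′ → height r t + d ≤ height r′ t′
  far-later-block {r} {r′} {t} {t′} r≤r′ t<t′ =
    subst (_≤ height r′ t′) (sym (height-step r t)) (+-mono-≤ r≤r′ (*-monoˡ-≤ d t<t′))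

  same-label-spots : ∀ p p′ → labC p ≡ labC p′ →
                     colC p ≡ colC p′ ⊎ (posC p + d ≤ posC p′ ⊎ posC p′ + d ≤ posC p)
  same-label-spots (r , t , a) (r′ , t′ , a′) same
    with combine-injective (level r t) a (level r′ t′) a′ (toℕ-injective same)
  ... | sameRow , refl with Fₚ.<-cmp t t′
  ... | tri< t<t′ _ _ = inj₂ (inj₁ (far-later-block (level-shared sameRow t<t′) t<t′))
  ... | tri≈ _ refl _ = inj₁ refl
  ... | tri> _ _ t′<t = inj₂ (inj₂ (far-later-block (level-shared (sym sameRow) t′<t) t′<t))

  same-label-comparable : ∀ x y → lab x ≡ lab y → Comparable x y
  same-label-comparable x y same = related (same-label-spots (coords x) (coords y) same)
    where
    related : col x ≡ col y ⊎ (pos x + d ≤ pos y ⊎ pos y + d ≤ pos x) → Comparable x y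
    related (inj₁ sameCol)            = column⇒comparable sameCol
    related (inj₂ (inj₁ x-far-below)) = far⇒comparable x-far-below
    related (inj₂ (inj₂ y-far-below)) = Sum.swap (far⇒comparable y-far-below)

  Apart : Coords → Coords → Set
  Apart p p′ = colC p ≢ colC p′ × Near (posC p) (posC p′)

  apart-points : ∀ p p′ → Apart p p′ → Incomparable (point p) (point p′)
  apart-points p p′ apart = Product.uncurry apart⇒incomparable
    (subst₂ Apart (sym (coords-point p)) (sym (coords-point p′)) apart)

  -- For a label (q , b) below the label (ℓ , a) of (r , t , a), the point
  -- (q , t , b) precedes (r , t , a), has label (q , b) and is apart from it,
  -- unless b = a: then the columns clash, and (q , t + 1 , a) does the job.
  witness-pair : ∀ r t a q b → toℕ (combine q b) < toℕ (combine (level r t) a) →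
                 q F.< level r t ⊎ (q ≡ level r t × b F.< a) →
                 Σ Coords λ p′ → toℕ (point p′) < toℕ (point (r , t , a)) ×
                                 labC p′ ≡ toℕ (combine q b) × Apart (r , t , a) p′
  witness-pair r t a q b below smaller = choose (b F.≟ a)
    where
    ℓ : Fin d
    ℓ = level r t
    q≤ℓ : toℕ q ≤ toℕ ℓ
    q≤ℓ = Sum.[ <⇒≤ , (λ (q≡ℓ , _) → ≤-reflexive (cong toℕ q≡ℓ)) ]′ smaller
    ℓa≤ra : toℕ (combine ℓ a) ≤ toℕ (combine r a)
    ℓa≤ra = subst₂ _≤_ (sym (toℕ-combine ℓ a)) (sym (toℕ-combine r a))
              (+-monoˡ-≤ (toℕ a) (*-monoʳ-≤ w (level≤row r t)))
    earlier : ∀ t′ → toℕ (point (q , t′ , b)) < toℕ (point (r , t , a))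
    earlier t′ = combine-monoˡ-< t′ t (<-≤-trans below ℓa≤ra)
    labelled : ∀ t′ → toℕ q ≤ d' ∸ toℕ t′ → labC (q , t′ , b) ≡ toℕ (combine q b)
    labelled t′ q≤cap = cong (λ ℓ′ → toℕ (combine ℓ′ b)) (level-of t′ q≤cap)
    choose : Dec (b ≡ a) → Σ Coords λ p′ → toℕ (point p′) < toℕ (point (r , t , a)) ×
                                           labC p′ ≡ toℕ (combine q b) × Apart (r , t , a) p′
    choose (no b≢a) =
      (q , t , b) , earlier t , labelled t (≤-trans q≤ℓ (level≤cap r t)) ,
      (λ e → b≢a (sym (colour-injective (toℕ t) e))) , near-same-block (toℕ t) (toℕ<n r) (toℕ<n q)
    choose (yes b≡a) =
      (q , t⁺ , b) , earlier t⁺ , labelled t⁺ q≤cap⁺ ,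
      moved , subst (λ s → Near (height (toℕ r) (toℕ t)) (height (toℕ q) s)) (sym t⁺≡)
                (near-next-block (toℕ t) (<-≤-trans q<ℓ (level≤row r t)) (toℕ<n r))
      where
      q<ℓ : q F.< ℓ
      q<ℓ = Sum.[ id , (λ (_ , b<a) → ⊥-elim (<-irrefl (cong toℕ b≡a) b<a)) ]′ smaller
      q<cap : toℕ q < d' ∸ toℕ t
      q<cap = <-≤-trans q<ℓ (level≤cap r t)
      t<d' : toℕ t < d'
      t<d' = m∸n≢0⇒n<m (λ cap≡0 → n≮0 (subst (toℕ q <_) cap≡0 q<cap))
      t⁺ : Fin d
      t⁺ = fromℕ< (s≤s t<d')
      t⁺≡ : toℕ t⁺ ≡ suc (toℕ t)
      t⁺≡ = toℕ-fromℕ< (s≤s t<d')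
      q≤cap⁺ : toℕ q ≤ d' ∸ toℕ t⁺
      q≤cap⁺ = subst (toℕ q ≤_) (trans (pred[m∸n]≡m∸[1+n] d' (toℕ t)) (cong (d' ∸_) (sym t⁺≡)))
                 (<⇒≤pred q<cap)
      moved : colour (toℕ t) a ≢ colour (toℕ t⁺) b
      moved e = rotate-moves (colour (toℕ t) a) (sym (trans e (cong₂ colour t⁺≡ b≡a)))

  witness-coords : ∀ p c → c < labC p →
                   Σ Coords λ p′ → toℕ (point p′) < toℕ (point p) × labC p′ ≡ c × Apart p p′
  witness-coords (r , t , a) c c<lab with combine-below (level r t) a c c<lab
  ... | q , b , refl , smaller = witness-pair r t a q b c<lab smaller

  incomparable-witness : ∀ v c → c < lab v →
                         Σ (Fin n) λ x → toℕ x < toℕ v × lab x ≡ c × Incomparable v x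
  incomparable-witness v c c<lab = located (witness-coords (coords v) c c<lab)
    where
    located : Σ Coords (λ p′ → toℕ (point p′) < toℕ (point (coords v)) × labC p′ ≡ c ×
                               Apart (coords v) p′) →
              Σ (Fin n) λ x → toℕ x < toℕ v × lab x ≡ c × Incomparable v x
    located (p′ , earlier , labelled , apart) =
      point p′ , subst (λ z → toℕ (point p′) < toℕ z) (point-coords v) earlier ,
      trans (cong labC (coords-point p′)) labelled ,
      subst (λ z → Incomparable z (point p′)) (point-coords v) (apart-points (coords v) p′ apart)

  -- the w points in row 0 of block 0 form an antichain, so the width is w
  width-w : HasWidth w
  width-w = (tabulate bottom , antichain , length-tabulate bottom) , width≤
    where
    bottom : Fin w → Fin n
    bottom a = point (zero , zero , a)
    bottom-injective : ∀ {a a′} → bottom a ≡ bottom a′ → a ≡ a′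
    bottom-injective {a} {a′} e = cong (proj₂ ∘ proj₂)
      (trans (sym (coords-point (zero , zero , a))) (trans (cong coords e) (coords-point (zero , zero , a′))))
    bottom-apart : ∀ {a a′} → a ≢ a′ → Incomparable (bottom a) (bottom a′)
    bottom-apart {a} {a′} a≢a′ = apart-points (zero , zero , a) (zero , zero , a′)
      (a≢a′ , near-same-block 0 (s≤s z≤n) (s≤s z≤n))
    antichain : IsAntichain (tabulate bottom)
    antichain = Unique.tabulate⁺ {f = bottom} bottom-injective , AllPairs.tabulate⁺ bottom-apart

  -- First-Fit uses at least d · w chains: the largest label d · w - 1 occurs
  many-chains : d * w ≤ length (firstFit (allFin n))
  many-chains = subst (λ c → suc c ≤ length (firstFit (allFin n))) top-label
                  (firstFit-bound lab same-label-comparable incomparable-witness (point (ℓ , zero , a)))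
    where
    top : Fin (d * w)
    top = F.fromℕ (suc w' + d' * w)
    ℓ : Fin d
    ℓ = proj₁ (remQuot {d} w top)
    a : Fin w
    a = proj₂ (remQuot {d} w top)
    top-label : lab (point (ℓ , zero , a)) ≡ suc w' + d' * w
    top-label = begin
      lab (point (ℓ , zero , a))         ≡⟨ cong labC (coords-point (ℓ , zero , a)) ⟩
      toℕ (combine (level ℓ zero) a)     ≡⟨ cong (λ ℓ′ → toℕ (combine ℓ′ a)) (level-of zero ℓ≤d') ⟩
      toℕ (combine ℓ a)                  ≡⟨ cong toℕ (combine-remQuot {d} w top) ⟩
      toℕ top                            ≡⟨ toℕ-fromℕ _ ⟩
      suc w' + d' * w                    ∎
      where
      open ≡.≡-Reasoning
      ℓ≤d' : toℕ ℓ ≤ d'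
      ℓ≤d' = ≤-pred (toℕ<n ℓ)

theorem6 : ∀ (k w : ℕ) → 2 ≤ k → 2 ≤ w →
    Σ ℕ λ n → Σ (Rel (Fin n) 0ℓ) λ _≼_ → Σ (IsDecPartialOrder _≡_ _≼_) λ po →
    Poset.HasWidth _≼_ po w × ¬ Poset.Contains-k+k _≼_ po k ×
    Σ (List (Fin n)) λ σ → (σ ↭ allFin n) ×
    ((k ∸ 1) * (w ∸ 1) ≤ length (Poset.firstFit _≼_ po σ))
theorem6 (suc (suc k′)) (suc (suc w′)) (s≤s (s≤s z≤n)) (s≤s (s≤s z≤n)) =
  n , _≼_ , isDecPartialOrder , width-w , no-k+k , allFin n , ↭-refl ,
  ≤-trans (*-monoʳ-≤ (suc k′) (n≤1+n (suc w′))) many-chains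
  where open Construction k′ w′
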